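{- Let $d \geq 1$ and define $$k(d)=\begin{cases} d-2, & d=1,\\ d-3, & 2\le d\le 4,\\ d-4, & d\ge 5.\end{cases}$$ In any $d$-set ridge cover $A_1,\dots,A_d$ of $C^d$ there is a set $A_i$ containing a pair of antipodal $k(d)$-faces. Moreover, for every $d \neq 5$, there exists a $d$-set ridge cover of $C^d$ in which no set contains a pair of antipodal $(k(d)+1)$-faces.
   Context: $C^d=[0,1]^d$. Every nonempty $k$-face of $C^d$ is described by its coordinate representation: a word in $\{0,1,X\}^d$ with exactly $k$ letters $X$; the face is the set of points of $C^d$ whose coordinates in the non-$X$ ("fixed") positions equal the given values, the $X$ positions being free ("varying"). The empty set is regarded as a face of dimension $-1$. Two $k$-faces are antipodal iff they have exactly the same set of fixed coordinate positions and differ in every fixed position (e.g. vertices are antipodal iff they differ in every coordinate); the empty set is antipodal to itself. A facet is a $(d-1)$-face, a ridge is a $(d-2)$-face. An $n$-set ridge cover of $C^d$ is a collection of $n$ sets $A_1,\dots,A_n$, each a union of ridges of $C^d$, such that every ridge of $C^d$ is contained in at least one $A_i$. A set $A$ contains a pair of antipodal $k$-faces if there are two antipodal $k$-faces both contained (as point sets) in $A$.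
   Formalization: Points of $C^d$ have rational coordinates in place of real ones, so containment of faces in the sets $A_i$ as point sets is tested on rational points. -}

module Defs where

open import Data.Nat using (ℕ; zero; suc) renaming (_+_ to _+ℕ_)
open import Data.Integer using (ℤ; +_; -[1+_]; _-_)
open import Data.Rational using (ℚ; 0ℚ; 1ℚ; _≤_)
open import Data.Fin using (Fin; zero; suc)
open import Data.Product using (Σ; ∃; _×_; _,_)
open import Data.Unit using (⊤)
open import Data.Empty using (⊥)
open import Relation.Binary.PropositionalEquality using (_≡_)
open import Level using (0ℓ)

data Letter : Set where
  𝟘 𝟙 X : Letter

-- A face of C^d: either the empty face (dimension -1) or a nonempty face
-- given by its coordinate representation, a word in {0,1,X}^d.
data Face (d : ℕ) : Set where
  empty : Face d
  word  : (Fin d → Letter) → Face d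

isX : Letter → ℕ
isX X = 1
isX 𝟘 = 0
isX 𝟙 = 0

countX : ∀ {d} → (Fin d → Letter) → ℕ
countX {zero}  w = 0
countX {suc d} w = isX (w zero) +ℕ countX (λ i → w (suc i))

dim : ∀ {d} → Face d → ℤ
dim empty    = -[1+ 0 ]
dim (word w) = + countX w

IsRidge : ∀ {d} → Face d → Set
IsRidge {d} F = dim F ≡ (+ d - + 2)

Point : ℕ → Set
Point d = Fin d → ℚ

inLetter : ℚ → Letter → Set
inLetter x 𝟘 = x ≡ 0ℚ
inLetter x 𝟙 = x ≡ 1ℚ
inLetter x X = (0ℚ ≤ x) × (x ≤ 1ℚ)

_∈F_ : ∀ {d} → Point d → Face d → Set
p ∈F empty  = ⊥
p ∈F word w = ∀ i → inLetter (p i) (w i)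

-- a union of ridges, given by the collection of ridges it is the union of
RidgeUnion : ℕ → Set₁
RidgeUnion d = Face d → Set

_∈U_ : ∀ {d} → Point d → RidgeUnion d → Set
_∈U_ {d} p A = ∃ λ (R : Face d) → A R × (p ∈F R)

_⊆U_ : ∀ {d} → Face d → RidgeUnion d → Set
_⊆U_ {d} F A = (p : Point d) → p ∈F F → p ∈U A

oppL : Letter → Letter → Set
oppL X X = ⊤
oppL 𝟘 𝟙 = ⊤
oppL 𝟙 𝟘 = ⊤
oppL _ _ = ⊥

Antipodal : ∀ {d} → Face d → Face d → Set
Antipodal empty    empty    = ⊤
Antipodal empty    (word _) = ⊥
Antipodal (word _) empty    = ⊥
Antipodal (word u) (word v) = ∀ i → oppL (u i) (v i)

ContainsAntipodal : ∀ {d} → RidgeUnion d → ℤ → Set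
ContainsAntipodal {d} A k =
  Σ (Face d) λ F → Σ (Face d) λ G →
    (dim F ≡ k) × (dim G ≡ k) × Antipodal F G × (F ⊆U A) × (G ⊆U A)

RidgeCover : (n d : ℕ) → (Fin n → RidgeUnion d) → Set
RidgeCover n d A =
  (∀ i (R : Face d) → A i R → IsRidge R) ×
  (∀ (R : Face d) → IsRidge R → ∃ λ (i : Fin n) → R ⊆U A i)

kd : ℕ → ℤ
kd 0 = + 0 - + 2
kd 1 = + 1 - + 2
kd 2 = + 2 - + 3
kd 3 = + 3 - + 3
kd 4 = + 4 - + 3
kd (suc (suc (suc (suc (suc n))))) = + (5 +ℕ n) - + 4

-- A ridge fixes two coordinates, so it is a pair of literals (coordinate, value).  If two ridges r
-- and s share no literal, then r ∩ (−s) is a face of dimension at least 2(d − 2) − d = d − 4, and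
-- every subface F of it gives antipodal faces F ⊆ r and −F ⊆ s.  Colouring each ridge by a set of
-- the cover that contains it, it therefore suffices to find two literal-disjoint ridges of the same
-- colour among d colours.  For d ≥ 5 pigeonhole against the cyclic matching x_j = 0, x_{j+1} = 1
-- forces every other ridge to take the colour of a matching ridge through one of its literals, and
-- eight well-chosen ridges then clash.  For d = 3 and d = 4 (where the two ridges must moreover
-- share a coordinate, so that r ∩ (−s) has dimension 1) the search is finite and is settled by a
-- checked decision tree.
--
-- Conversely, antipodal ridges have opposite first fixed letters, so colouring ridges by their first
-- fixed letter works for 2 ≤ d ≤ 4.  For d ≥ 6 colour a ridge by a row of a binary covering array of
-- strength two that agrees with its fixed letters: a face and its antipode lying in ridges of one
-- class cannot both be fixed in a coordinate, which bounds their dimension by d − 4.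

module Submission where

open import Defs
open import Data.Nat using (ℕ; _≤_)
open import Data.Integer using (_+_; +_)
open import Data.Fin using (Fin)
open import Data.Product using (Σ; ∃; _×_)
open import Relation.Binary.PropositionalEquality using (_≢_)
open import Relation.Nullary using (¬_)

open import Data.Bool using (Bool; true; false; not)
import Data.Bool.Properties as Bool
open import Data.Bool.Properties using (not-¬)
open import Data.Empty using (⊥; ⊥-elim)
open import Data.Fin using (zero; suc; _≟_; #_; toℕ; fromℕ; fromℕ<; inject₁; punchIn)
open import Data.Fin.Properties
  using ( toℕ<n; toℕ-injective; toℕ-fromℕ<; suc-injective; inject₁-injective; fromℕ≢inject₁
        ; punchInᵢ≢i; punchIn-injective; <⇒≢; any?; all?; pigeonhole; injective⇒≤)
open import Data.Integer using (_-_)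
import Data.Integer.Properties as ℤ
open import Data.List using (List; []; _∷_; tabulate)
open import Data.List.Relation.Unary.All using (All; []; _∷_)
open import Data.List.Relation.Unary.All.Properties using (tabulate⁺)
open import Data.Maybe using (Maybe; just; nothing)
import Data.Maybe as Maybe
open import Data.Maybe.Properties using (just-injective)
open import Data.Nat using (zero; suc; _<_; z≤n; s≤s) renaming (_+_ to _+ℕ_)
import Data.Nat.Properties as ℕ
open import Data.Nat.Tactic.RingSolver using (solve-∀)
open import Data.Product using (_,_; proj₁; proj₂; uncurry)
open import Data.Product.Properties using (≡-dec)
open import Data.Rational using (ℚ; 0ℚ; 1ℚ; ½)
import Data.Rational as ℚ
open import Data.Sum using (_⊎_; inj₁; inj₂; reduce)
import Data.Sum.Effectful.Left
open import Data.Unit using (⊤; tt)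
open import Data.Vec using (Vec; []; _∷_; lookup; allFin)
open import Data.Vec.Properties using (lookup-allFin)
open import Data.Vec.Functional using (tail; updateAt) renaming (_∷_ to _∷ʷ_)
open import Data.Vec.Functional.Properties using (updateAt-updates; updateAt-minimal)
open import Effect.Monad using (RawMonad)
open import Function using (_∘_)
open import Function.Definitions using (Injective)
open import Level using (0ℓ)
open import Relation.Binary.PropositionalEquality
  using (_≡_; refl; sym; trans; cong; cong₂; subst; subst₂; module ≡-Reasoning)
open import Relation.Nullary using (Dec; yes; no; ¬?; _×-dec_; _⊎-dec_; contradiction)
open import Relation.Nullary.Decidable using (True; does; toWitness; map′; dec-true; dec-false; _→-dec_)
open import Algebra.Properties.CommutativeSemigroup ℕ.+-commutativeSemigroup using (interchange)

-- Faces as words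

Word : ℕ → Set
Word d = Fin d → Letter

fix : Bool → Letter
fix false = 𝟘
fix true  = 𝟙

antipode : Letter → Letter
antipode 𝟘 = 𝟙
antipode 𝟙 = 𝟘
antipode X = X

infix 4 _⊑_ _⊑ʷ_

data _⊑_ : Letter → Letter → Set where
  ⊑-refl : ∀ {x} → x ⊑ x
  ⊑-X    : ∀ {x} → x ⊑ X

_⊑ʷ_ : ∀ {d} → Word d → Word d → Set
u ⊑ʷ v = ∀ j → u j ⊑ v j

⊑-trans : ∀ {x y z} → x ⊑ y → y ⊑ z → x ⊑ z
⊑-trans p ⊑-refl = p
⊑-trans _ ⊑-X    = ⊑-X

antipode-⊑ : ∀ {x y} → x ⊑ y → antipode x ⊑ antipode y
antipode-⊑ ⊑-refl = ⊑-refl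
antipode-⊑ ⊑-X    = ⊑-X

antipode-opp : ∀ x → oppL x (antipode x)
antipode-opp 𝟘 = tt
antipode-opp 𝟙 = tt
antipode-opp X = tt

centre : Letter → ℚ
centre 𝟘 = 0ℚ
centre 𝟙 = 1ℚ
centre X = ½

centre-∈ : ∀ x → inLetter (centre x) x
centre-∈ 𝟘 = refl
centre-∈ 𝟙 = refl
centre-∈ X = toWitness {a? = 0ℚ ℚ.≤? ½} _ , toWitness {a? = ½ ℚ.≤? 1ℚ} _

centre-∈⇒⊑ : ∀ x y → inLetter (centre x) y → x ⊑ y
centre-∈⇒⊑ _ X _ = ⊑-X
centre-∈⇒⊑ 𝟘 𝟘 _ = ⊑-refl
centre-∈⇒⊑ 𝟙 𝟙 _ = ⊑-refl
centre-∈⇒⊑ 𝟘 𝟙 ()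
centre-∈⇒⊑ 𝟙 𝟘 ()
centre-∈⇒⊑ X 𝟘 ()
centre-∈⇒⊑ X 𝟙 ()

∈-⊑ : ∀ {q x y} → inLetter q x → x ⊑ y → inLetter q y
∈-⊑ q∈x ⊑-refl = q∈x
∈-⊑ {x = 𝟘} refl ⊑-X = toWitness {a? = 0ℚ ℚ.≤? 0ℚ} _ , toWitness {a? = 0ℚ ℚ.≤? 1ℚ} _
∈-⊑ {x = 𝟙} refl ⊑-X = toWitness {a? = 0ℚ ℚ.≤? 1ℚ} _ , toWitness {a? = 1ℚ ℚ.≤? 1ℚ} _
∈-⊑ {x = X} q∈x  ⊑-X = q∈x

LiesIn : ∀ {d} → RidgeUnion d → Word d → Set
LiesIn {d} A w = Σ (Word d) λ w′ → A (word w′) × w ⊑ʷ w′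

-- The centre of a face lies only in the faces that contain the whole face.
⊆U⇒LiesIn : ∀ {d} {A : RidgeUnion d} (w : Word d) → word w ⊆U A → LiesIn A w
⊆U⇒LiesIn w w⊆A with w⊆A (λ j → centre (w j)) (λ j → centre-∈ (w j))
... | word w′ , w′∈A , c∈w′ = w′ , w′∈A , λ j → centre-∈⇒⊑ (w j) (w′ j) (c∈w′ j)

LiesIn⇒⊆U : ∀ {d} {A : RidgeUnion d} {w v : Word d} → LiesIn A w → v ⊑ʷ w → word v ⊆U A
LiesIn⇒⊆U (w′ , w′∈A , w⊑w′) v⊑w p p∈v =
  word w′ , w′∈A , λ j → ∈-⊑ (p∈v j) (⊑-trans (v⊑w j) (w⊑w′ j))

-- Dimension of faces

countX-mono₂ : ∀ {d} (u v w z : Word d) →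
               (∀ j → isX (u j) +ℕ isX (v j) ≤ isX (w j) +ℕ isX (z j)) →
               countX u +ℕ countX v ≤ countX w +ℕ countX z
countX-mono₂ {zero}  _ _ _ _ _  = z≤n
countX-mono₂ {suc d} u v w z le = begin
  (isX (u zero) +ℕ countX (tail u)) +ℕ (isX (v zero) +ℕ countX (tail v))
    ≡⟨ interchange (isX (u zero)) _ _ _ ⟩
  (isX (u zero) +ℕ isX (v zero)) +ℕ (countX (tail u) +ℕ countX (tail v))
    ≤⟨ ℕ.+-mono-≤ (le zero) (countX-mono₂ (tail u) (tail v) (tail w) (tail z) (λ j → le (suc j))) ⟩
  (isX (w zero) +ℕ isX (z zero)) +ℕ (countX (tail w) +ℕ countX (tail z))
    ≡⟨ interchange (isX (w zero)) _ _ _ ⟨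
  (isX (w zero) +ℕ countX (tail w)) +ℕ (isX (z zero) +ℕ countX (tail z)) ∎
  where open ℕ.≤-Reasoning

allX : ∀ {d} → Word d
allX _ = X

countX-allX : ∀ d → countX {d} allX ≡ d
countX-allX zero    = refl
countX-allX (suc d) = cong suc (countX-allX d)

countX-antipode : ∀ {d} (w : Word d) → countX (λ j → antipode (w j)) ≡ countX w
countX-antipode {zero}  _ = refl
countX-antipode {suc d} w = cong₂ _+ℕ_ (isX-antipode (w zero)) (countX-antipode (tail w))
  where
  isX-antipode : ∀ x → isX (antipode x) ≡ isX x
  isX-antipode 𝟘 = refl
  isX-antipode 𝟙 = refl
  isX-antipode X = refl

isX-mono : ∀ {x y} → x ⊑ y → isX x ≤ isX y
isX-mono {y = 𝟘} ⊑-refl = z≤n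
isX-mono {y = 𝟙} ⊑-refl = z≤n
isX-mono {y = X} ⊑-refl = s≤s z≤n
isX-mono {𝟘} ⊑-X = z≤n
isX-mono {𝟙} ⊑-X = z≤n
isX-mono {X} ⊑-X = s≤s z≤n

countX-mono : ∀ {d} {u v : Word d} → u ⊑ʷ v → countX u ≤ countX v
countX-mono {d} {u} {v} u⊑v = ℕ.+-cancelʳ-≤ (countX {d} allX) _ _
  (countX-mono₂ u allX v allX (λ j → ℕ.+-monoˡ-≤ 1 (isX-mono (u⊑v j))))

⊑-tight-step : ∀ {x y a b} → x ⊑ y → a ≤ b → isX y +ℕ b ≤ isX x +ℕ a → x ≡ y × b ≤ a
⊑-tight-step {x} ⊑-refl _ b≤a = refl , ℕ.+-cancelˡ-≤ (isX x) _ _ b≤a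
⊑-tight-step {X} ⊑-X    _ b≤a = refl , ℕ.+-cancelˡ-≤ 1 _ _ b≤a
⊑-tight-step {𝟘} ⊑-X  a≤b b<a = ⊥-elim (ℕ.<⇒≱ b<a a≤b)
⊑-tight-step {𝟙} ⊑-X  a≤b b<a = ⊥-elim (ℕ.<⇒≱ b<a a≤b)

⊑ʷ-tight : ∀ {d} {u v : Word d} → u ⊑ʷ v → countX v ≤ countX u → ∀ j → u j ≡ v j
⊑ʷ-tight {suc d} u⊑v v≤u j
  with ⊑-tight-step (u⊑v zero) (countX-mono (λ j → u⊑v (suc j))) v≤u
⊑ʷ-tight u⊑v v≤u zero    | u₀≡v₀ , _ = u₀≡v₀
⊑ʷ-tight u⊑v v≤u (suc j) | _ , tail≤ = ⊑ʷ-tight (λ j → u⊑v (suc j)) tail≤ j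

letter-view : ∀ x → x ≡ X ⊎ Σ Bool λ b → x ≡ fix b
letter-view 𝟘 = inj₂ (false , refl)
letter-view 𝟙 = inj₂ (true , refl)
letter-view X = inj₁ refl

fixed-position : ∀ {d} (w : Word d) → countX w < d → Σ (Fin d) λ p → Σ Bool λ b → w p ≡ fix b
fixed-position {suc d} w c<d with letter-view (w zero)
... | inj₂ (b , w₀≡b) = zero , b , w₀≡b
... | inj₁ w₀≡X
  with fixed-position (tail w) (ℕ.≤-pred (subst (λ x → isX x +ℕ countX (tail w) < suc d) w₀≡X c<d))
...   | p , b , wp≡b = suc p , b , wp≡b

countX-updateAt : ∀ {d} (w : Word d) i f →
                  countX (updateAt w i f) +ℕ isX (w i) ≡ countX w +ℕ isX (f (w i))
countX-updateAt w zero f = swap-outer (isX (f (w zero))) (countX (tail w)) (isX (w zero))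
  where
  swap-outer : ∀ a b c → a +ℕ b +ℕ c ≡ c +ℕ b +ℕ a
  swap-outer = solve-∀
countX-updateAt w (suc i) f = begin
  isX (w zero) +ℕ countX (updateAt (tail w) i f) +ℕ isX (w (suc i))
    ≡⟨ ℕ.+-assoc (isX (w zero)) _ _ ⟩
  isX (w zero) +ℕ (countX (updateAt (tail w) i f) +ℕ isX (w (suc i)))
    ≡⟨ cong (isX (w zero) +ℕ_) (countX-updateAt (tail w) i f) ⟩
  isX (w zero) +ℕ (countX (tail w) +ℕ isX (f (w (suc i))))
    ≡⟨ ℕ.+-assoc (isX (w zero)) _ _ ⟨
  isX (w zero) +ℕ countX (tail w) +ℕ isX (f (w (suc i))) ∎
  where open ≡-Reasoning

fix≢X : ∀ b → fix b ≢ X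
fix≢X false ()
fix≢X true  ()

isX-fix : ∀ b → isX (fix b) ≡ 0
isX-fix false = refl
isX-fix true  = refl

fixAt : ∀ {d} → Word d → Fin d → Bool → Word d
fixAt w p b = updateAt w p λ _ → fix b

free : ∀ {d} → Word d → Fin d → Word d
free w p = updateAt w p λ _ → X

countX-fix : ∀ {d} (w : Word d) p b → w p ≡ X → countX (fixAt w p b) +ℕ 1 ≡ countX w
countX-fix w p b wp≡X = begin
  countX w′ +ℕ 1          ≡⟨ cong (λ x → countX w′ +ℕ isX x) wp≡X ⟨
  countX w′ +ℕ isX (w p)  ≡⟨ countX-updateAt w p _ ⟩
  countX w +ℕ isX (fix b) ≡⟨ cong (countX w +ℕ_) (isX-fix b) ⟩
  countX w +ℕ 0           ≡⟨ ℕ.+-identityʳ _ ⟩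
  countX w                ∎
  where
  open ≡-Reasoning
  w′ = fixAt w p b

countX-free : ∀ {d} (w : Word d) p b → w p ≡ fix b → countX (free w p) ≡ countX w +ℕ 1
countX-free w p b wp≡b = begin
  countX w′                ≡⟨ ℕ.+-identityʳ _ ⟨
  countX w′ +ℕ 0           ≡⟨ cong (countX w′ +ℕ_) (isX-fix b) ⟨
  countX w′ +ℕ isX (fix b) ≡⟨ cong (λ x → countX w′ +ℕ isX x) wp≡b ⟨
  countX w′ +ℕ isX (w p)   ≡⟨ countX-updateAt w p _ ⟩
  countX w +ℕ 1            ∎
  where
  open ≡-Reasoning
  w′ = free w p

countX≡d⇒allX : ∀ {d} (w : Word d) → countX w ≡ d → ∀ j → w j ≡ X
countX≡d⇒allX {d} w c≡d = ⊑ʷ-tight (λ _ → ⊑-X) (ℕ.≤-reflexive (trans (countX-allX d) (sym c≡d)))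

subface : ∀ {d} (w : Word d) t → t ≤ countX w → Σ (Word d) λ v → v ⊑ʷ w × countX v ≡ t
subface {zero}  w zero z≤n = w , (λ ()) , refl
subface {suc d} w t t≤ with shrink-head (w zero) t t≤
  where
  shrink-head : ∀ x t {c} → t ≤ isX x +ℕ c → Σ Letter λ y → y ⊑ x × Σ ℕ λ t′ → t′ ≤ c × isX y +ℕ t′ ≡ t
  shrink-head 𝟘 t       t≤c       = 𝟘 , ⊑-refl , t , t≤c , refl
  shrink-head 𝟙 t       t≤c       = 𝟙 , ⊑-refl , t , t≤c , refl
  shrink-head X zero    _         = 𝟘 , ⊑-X , 0 , z≤n , refl
  shrink-head X (suc t) (s≤s t≤c) = X , ⊑-refl , t , t≤c , refl
... | y , y⊑w₀ , t′ , t′≤ , t≡ with subface (tail w) t′ t′≤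
...   | v , v⊑ , v-dim =
  (y ∷ʷ v) , (λ { zero → y⊑w₀ ; (suc j) → v⊑ j }) , trans (cong (isX y +ℕ_) v-dim) t≡

-- Ridges

record Ridge (d : ℕ) : Set where
  constructor ridge
  field
    pos₁ pos₂ : Fin d
    val₁ val₂ : Bool
    pos₁≢pos₂ : pos₁ ≢ pos₂

  lit₁ lit₂ : Fin d × Bool
  lit₁ = pos₁ , val₁
  lit₂ = pos₂ , val₂

open Ridge

⟦_⟧ : ∀ {d} → Ridge d → Word d
⟦ ridge p q u v _ ⟧ = fixAt (fixAt allX p u) q v

countX⇒IsRidge : ∀ {d} (w : Word d) → countX w +ℕ 2 ≡ d → IsRidge (word w)
countX⇒IsRidge w c+2≡d = subst (λ n → + countX w ≡ + n - + 2) c+2≡d (cancel-2 (countX w))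
  where
  cancel-2 : ∀ c → + c ≡ + (c +ℕ 2) - + 2
  cancel-2 c rewrite ℕ.+-comm c 2 = refl

IsRidge⇒countX : ∀ {d} (w : Word d) → IsRidge (word w) → countX w +ℕ 2 ≡ d
IsRidge⇒countX {zero}        w ()
IsRidge⇒countX {suc zero}    w ()
IsRidge⇒countX {suc (suc d)} w c≡d = trans (cong (_+ℕ 2) (ℤ.+-injective c≡d)) (ℕ.+-comm d 2)

countX-⟦⟧ : ∀ {d} (r : Ridge d) → countX ⟦ r ⟧ +ℕ 2 ≡ d
countX-⟦⟧ {d} (ridge p q u v p≢q) = begin
  countX w₂ +ℕ 2         ≡⟨ ℕ.+-assoc (countX w₂) 1 1 ⟨
  countX w₂ +ℕ 1 +ℕ 1    ≡⟨ cong (_+ℕ 1) (countX-fix w₁ q v (updateAt-minimal q p allX (p≢q ∘ sym))) ⟩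
  countX w₁ +ℕ 1         ≡⟨ countX-fix allX p u refl ⟩
  countX {d} allX        ≡⟨ countX-allX d ⟩
  d                      ∎
  where
  open ≡-Reasoning
  w₁ = fixAt allX p u
  w₂ = fixAt w₁ q v

⟦⟧-isRidge : ∀ {d} (r : Ridge d) → IsRidge (word ⟦ r ⟧)
⟦⟧-isRidge r = countX⇒IsRidge _ (countX-⟦⟧ r)

ridge-view : ∀ {d} (w : Word d) → countX w +ℕ 2 ≡ d → Σ (Ridge d) λ r → ∀ j → w j ≡ ⟦ r ⟧ j
ridge-view {d} w c+2≡d
  with fixed-position w (subst (countX w <_) c+2≡d (ℕ.m<m+n _ (s≤s z≤n)))
... | p , u , wp≡u
  with fixed-position (free w p)
         (subst (_< d) (sym (countX-free w p u wp≡u))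
           (subst (countX w +ℕ 1 <_) c+2≡d (ℕ.+-monoʳ-< (countX w) (s≤s (s≤s z≤n)))))
...   | q , v , w₁q≡v = ridge p q u v p≢q , agree
  where
  w₁ = free w p
  q≢p : q ≢ p
  q≢p refl = fix≢X v (trans (sym w₁q≡v) (updateAt-updates p w))
  p≢q : p ≢ q
  p≢q = q≢p ∘ sym
  wq≡v : w q ≡ fix v
  wq≡v = trans (sym (updateAt-minimal q p w q≢p)) w₁q≡v
  freed : ∀ j → free w₁ q j ≡ X
  freed = countX≡d⇒allX _ (begin
    countX (free w₁ q)  ≡⟨ countX-free w₁ q v w₁q≡v ⟩
    countX w₁ +ℕ 1      ≡⟨ cong (_+ℕ 1) (countX-free w p u wp≡u) ⟩
    countX w +ℕ 1 +ℕ 1  ≡⟨ ℕ.+-assoc (countX w) 1 1 ⟩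
    countX w +ℕ 2       ≡⟨ c+2≡d ⟩
    d                   ∎)
    where open ≡-Reasoning
  agree : ∀ j → w j ≡ ⟦ ridge p q u v p≢q ⟧ j
  agree j with j ≟ q | j ≟ p
  ... | yes refl | _ = trans wq≡v (sym (updateAt-updates q _))
  ... | no j≢q | yes refl =
    trans wp≡u (sym (trans (updateAt-minimal p q _ j≢q) (updateAt-updates p allX)))
  ... | no j≢q | no j≢p = begin
    w j             ≡⟨ updateAt-minimal j p w j≢p ⟨
    w₁ j            ≡⟨ updateAt-minimal j q w₁ j≢q ⟨
    free w₁ q j     ≡⟨ freed j ⟩
    X               ≡⟨ updateAt-minimal j p allX j≢p ⟨
    fixAt allX p u j ≡⟨ updateAt-minimal j q _ j≢q ⟨
    ⟦ ridge p q u v p≢q ⟧ j ∎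
    where open ≡-Reasoning

infix 4 _∋_

_∋_ : ∀ {d} → Ridge d → Fin d × Bool → Set
r ∋ ℓ = ℓ ≡ lit₁ r ⊎ ℓ ≡ lit₂ r

Disjoint : ∀ {d} → Ridge d → Ridge d → Set
Disjoint r s = ∀ ℓ → r ∋ ℓ → ¬ s ∋ ℓ

fix-injective : ∀ {a b} → fix a ≡ fix b → a ≡ b
fix-injective {false} {false} _ = refl
fix-injective {true}  {true}  _ = refl

⟦⟧-fixed : ∀ {d} (r : Ridge d) {x b} → ⟦ r ⟧ x ≡ fix b → r ∋ (x , b)
⟦⟧-fixed (ridge p q u v _) {x} rx≡b with x ≟ q | x ≟ p
... | yes refl | _ = inj₂ (cong (q ,_) (sym (fix-injective (trans (sym (updateAt-updates q _)) rx≡b))))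
... | no x≢q | yes refl = inj₁ (cong (p ,_) (sym (fix-injective
  (trans (sym (trans (updateAt-minimal p q _ x≢q) (updateAt-updates p allX))) rx≡b))))
... | no x≢q | no x≢p = ⊥-elim (fix≢X _ (trans (sym rx≡b)
  (trans (updateAt-minimal x q _ x≢q) (updateAt-minimal x p allX x≢p))))

_∋?_ : ∀ {d} (r : Ridge d) ℓ → Dec (r ∋ ℓ)
r ∋? ℓ = ≡-dec _≟_ Bool._≟_ ℓ (lit₁ r) ⊎-dec ≡-dec _≟_ Bool._≟_ ℓ (lit₂ r)

disjoint-by-literals : ∀ {d} {r s : Ridge d} → ¬ s ∋ lit₁ r → ¬ s ∋ lit₂ r → Disjoint r s
disjoint-by-literals ∌₁ ∌₂ _ (inj₁ refl) = ∌₁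
disjoint-by-literals ∌₁ ∌₂ _ (inj₂ refl) = ∌₂

disjoint? : ∀ {d} (r s : Ridge d) → Dec (Disjoint r s)
disjoint? r s = map′ (uncurry (disjoint-by-literals {r = r} {s}))
                     (λ disj → disj _ (inj₁ refl) , disj _ (inj₂ refl))
                     (¬? (s ∋? lit₁ r) ×-dec ¬? (s ∋? lit₂ r))

disjoint : ∀ {d} (r s : Ridge d) → {True (disjoint? r s)} → Disjoint r s
disjoint r s {checked} = toWitness checked

-- Antipodal faces in two ridges

data SameFixed : Letter → Letter → Set where
  both𝟘 : SameFixed 𝟘 𝟘
  both𝟙 : SameFixed 𝟙 𝟙

Apart : ∀ {d} → Word d → Word d → Set
Apart u v = ∀ j → ¬ SameFixed (u j) (v j)

meet⁻ : Letter → Letter → Letter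
meet⁻ X y = antipode y
meet⁻ x _ = x

-- The face u ∩ (−v), nonempty when u and v are apart.
meetAntipode : ∀ {d} → Word d → Word d → Word d
meetAntipode u v j = meet⁻ (u j) (v j)

meetAntipode-⊑ˡ : ∀ {d} (u v : Word d) → meetAntipode u v ⊑ʷ u
meetAntipode-⊑ˡ u v j with u j
... | 𝟘 = ⊑-refl
... | 𝟙 = ⊑-refl
... | X = ⊑-X

meetAntipode-⊑ʳ : ∀ {d} {u v : Word d} → Apart u v → (λ j → antipode (meetAntipode u v j)) ⊑ʷ v
meetAntipode-⊑ʳ {u = u} {v} apart j with u j | v j | apart j
... | 𝟘 | 𝟘 | ¬same = ⊥-elim (¬same both𝟘)
... | 𝟙 | 𝟙 | ¬same = ⊥-elim (¬same both𝟙)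
... | 𝟘 | 𝟙 | _ = ⊑-refl
... | 𝟙 | 𝟘 | _ = ⊑-refl
... | 𝟘 | X | _ = ⊑-X
... | 𝟙 | X | _ = ⊑-X
... | X | 𝟘 | _ = ⊑-refl
... | X | 𝟙 | _ = ⊑-refl
... | X | X | _ = ⊑-refl

countX-meetAntipode : ∀ {d} (u v : Word d) → countX u +ℕ countX v ≤ countX (meetAntipode u v) +ℕ d
countX-meetAntipode {d} u v =
  subst (countX u +ℕ countX v ≤_) (cong (countX (meetAntipode u v) +ℕ_) (countX-allX d))
    (countX-mono₂ u v (meetAntipode u v) allX (λ j → pointwise (u j) (v j)))
  where
  pointwise : ∀ x y → isX x +ℕ isX y ≤ isX (meet⁻ x y) +ℕ 1
  pointwise 𝟘 y = isX-mono {y} ⊑-X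
  pointwise 𝟙 y = isX-mono {y} ⊑-X
  pointwise X 𝟘 = s≤s z≤n
  pointwise X 𝟙 = s≤s z≤n
  pointwise X X = ℕ.≤-refl

antipodal-faces : ∀ {d} {A : RidgeUnion d} {u v : Word d} → LiesIn A u → LiesIn A v → Apart u v →
                  ∀ k → k ≤ countX (meetAntipode u v) → ContainsAntipodal A (+ k)
antipodal-faces {u = u} {v} u∈A v∈A apart k k≤ with subface (meetAntipode u v) k k≤
... | F , F⊑ , dim-F =
  word F , word (λ j → antipode (F j)) , cong +_ dim-F , cong +_ (trans (countX-antipode F) dim-F) ,
  (λ j → antipode-opp (F j)) ,
  LiesIn⇒⊆U u∈A (λ j → ⊑-trans (F⊑ j) (meetAntipode-⊑ˡ u v j)) ,
  LiesIn⇒⊆U v∈A (λ j → ⊑-trans (antipode-⊑ (F⊑ j)) (meetAntipode-⊑ʳ apart j))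

Disjoint⇒Apart : ∀ {d} {r s : Ridge d} → Disjoint r s → Apart ⟦ r ⟧ ⟦ s ⟧
Disjoint⇒Apart {r = r} {s} disj j same with sameFixed-view same
  where
  sameFixed-view : ∀ {x y} → SameFixed x y → Σ Bool λ b → x ≡ fix b × y ≡ fix b
  sameFixed-view both𝟘 = false , refl , refl
  sameFixed-view both𝟙 = true , refl , refl
... | b , rj≡b , sj≡b = disj _ (⟦⟧-fixed r rj≡b) (⟦⟧-fixed s sj≡b)

AntipodalFaces : ∀ {d} → ℕ → Ridge d → Ridge d → Set
AntipodalFaces k r s = Disjoint r s × k ≤ countX (meetAntipode ⟦ r ⟧ ⟦ s ⟧)

antipodalFaces? : ∀ {d} k (r s : Ridge d) → Dec (AntipodalFaces k r s)
antipodalFaces? k r s = disjoint? r s ×-dec k ℕ.≤? countX (meetAntipode ⟦ r ⟧ ⟦ s ⟧)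

meetAntipode-dim : ∀ {n} (r s : Ridge (4 +ℕ n)) → n ≤ countX (meetAntipode ⟦ r ⟧ ⟦ s ⟧)
meetAntipode-dim {n} r s = ℕ.+-cancelʳ-≤ (4 +ℕ n) n _ (begin
  n +ℕ (4 +ℕ n)                   ≡⟨ double-halves n ⟩
  (2 +ℕ n) +ℕ (2 +ℕ n)            ≡⟨ cong₂ _+ℕ_ (count r) (count s) ⟨
  countX ⟦ r ⟧ +ℕ countX ⟦ s ⟧    ≤⟨ countX-meetAntipode ⟦ r ⟧ ⟦ s ⟧ ⟩
  countX (meetAntipode ⟦ r ⟧ ⟦ s ⟧) +ℕ (4 +ℕ n) ∎)
  where
  open ℕ.≤-Reasoning
  double-halves : ∀ n → n +ℕ (4 +ℕ n) ≡ (2 +ℕ n) +ℕ (2 +ℕ n)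
  double-halves = solve-∀
  count : ∀ r → countX ⟦ r ⟧ ≡ 2 +ℕ n
  count r = ℕ.+-cancelʳ-≡ 2 _ _ (trans (countX-⟦⟧ r) (ℕ.+-comm 2 (2 +ℕ n)))

disjoint⇒antipodalFaces : ∀ {n} (r s : Ridge (4 +ℕ n)) → Disjoint r s → AntipodalFaces n r s
disjoint⇒antipodalFaces r s disj = disj , meetAntipode-dim r s

-- Monochromatic pairs

MonochromaticPair : ∀ {I : Set} {m} → (I → Fin m) → (I → I → Set) → Set
MonochromaticPair {I} c R = Σ I λ r → Σ I λ s → c r ≡ c s × R r s

map-pair : ∀ {I : Set} {m} {c : I → Fin m} {R R′ : I → I → Set} →
           (∀ r s → R r s → R′ r s) → MonochromaticPair c R → MonochromaticPair c R′
map-pair f (r , s , same , Rrs) = r , s , same , f r s Rrs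

triangle : ∀ {I : Set} {m} {c : I → Fin m} {R : I → I → Set} {ρ ρ′ s s′ κ κ′} →
           c ρ ≡ κ → c ρ′ ≡ κ → c s ≡ κ′ ⊎ c s ≡ κ → c s′ ≡ κ′ ⊎ c s′ ≡ κ →
           R s s′ → R s ρ′ → R s′ ρ → MonochromaticPair c R
triangle {ρ′ = ρ′} {s} _ cρ′ (inj₂ cs) _ _ Rsρ′ _ = s , ρ′ , trans cs (sym cρ′) , Rsρ′
triangle {ρ = ρ} {s′ = s′} cρ _ (inj₁ _) (inj₂ cs′) _ _ Rs′ρ = s′ , ρ , trans cs′ (sym cρ) , Rs′ρ
triangle {s = s} {s′} _ _ (inj₁ cs) (inj₁ cs′) Rss′ _ _ = s , s′ , trans cs (sym cs′) , Rss′

-- i ↦ i + 1 modulo n + 1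
next : ∀ {n} → Fin (suc n) → Fin (suc n)
next {zero}  _       = zero
next {suc n} zero    = suc zero
next {suc n} (suc i) = punchIn (suc zero) (next i)

next-injective : ∀ {n} {i j : Fin (suc n)} → next i ≡ next j → i ≡ j
next-injective {zero}  {zero}  {zero}  _ = refl
next-injective {suc n} {zero}  {zero}  _ = refl
next-injective {suc n} {zero}  {suc j} e = ⊥-elim (punchInᵢ≢i (suc zero) (next j) (sym e))
next-injective {suc n} {suc i} {zero}  e = ⊥-elim (punchInᵢ≢i (suc zero) (next i) e)
next-injective {suc n} {suc i} {suc j} e =
  cong suc (next-injective (punchIn-injective (suc zero) _ _ e))

next-fixfree : ∀ {n} (i : Fin (2 +ℕ n)) → next i ≢ i
next-fixfree {n}     zero          ()
next-fixfree {zero}  (suc zero)    ()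
next-fixfree {suc n} (suc i) e with next i in next-i
... | zero  = contradiction e λ ()
... | suc k = next-fixfree i (trans next-i (suc-injective e))

matching : ∀ {n} → Fin (2 +ℕ n) → Ridge (2 +ℕ n)
matching j = ridge j (next j) false true (next-fixfree j ∘ sym)

matching-disjoint : ∀ {n} {i j : Fin (2 +ℕ n)} → i ≢ j → Disjoint (matching i) (matching j)
matching-disjoint i≢j _ (inj₁ refl) (inj₁ e) = i≢j (cong proj₁ e)
matching-disjoint i≢j _ (inj₂ refl) (inj₂ e) = i≢j (next-injective (cong proj₁ e))

Owns : ∀ {n} → Fin (2 +ℕ n) → Fin (2 +ℕ n) × Bool → Set
Owns j ℓ = ∀ j′ → matching j′ ∋ ℓ → j′ ≡ j

owns-𝟘 : ∀ {n} (p : Fin (2 +ℕ n)) → Owns p (p , false)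
owns-𝟘 p j′ (inj₁ e) = sym (cong proj₁ e)

owns-𝟙 : ∀ {n} (j : Fin (2 +ℕ n)) → Owns j (next j , true)
owns-𝟙 j j′ (inj₂ e) = next-injective (sym (cong proj₁ e))

module _ {n} (c : Ridge (2 +ℕ n) → Fin (2 +ℕ n)) where

  LikeOwner : Ridge (2 +ℕ n) → Fin (2 +ℕ n) → Fin (2 +ℕ n) → Set
  LikeOwner r jp jq = c r ≡ c (matching jp) ⊎ c r ≡ c (matching jq)

  -- Pigeonhole on r and the d ridges of the matching.
  coloured-like-owner : ∀ r {jp jq} → Owns jp (lit₁ r) → Owns jq (lit₂ r) →
                        MonochromaticPair c Disjoint ⊎ LikeOwner r jp jq
  coloured-like-owner r own₁ own₂ with pigeonhole (ℕ.n<1+n _) (c ∘ item)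
    where
    item : Fin (3 +ℕ n) → Ridge (2 +ℕ n)
    item zero    = r
    item (suc j) = matching j
  ... | suc i , suc j , i<j , cᵢ≡cⱼ =
    inj₁ (matching i , matching j , cᵢ≡cⱼ , matching-disjoint (<⇒≢ (ℕ.≤-pred i<j)))
  ... | zero , suc j , _ , cr≡cⱼ with matching j ∋? lit₁ r | matching j ∋? lit₂ r
  ...   | yes ∋₁ | _      = inj₂ (inj₁ (subst (λ k → c r ≡ c (matching k)) (own₁ j ∋₁) cr≡cⱼ))
  ...   | no _   | yes ∋₂ = inj₂ (inj₂ (subst (λ k → c r ≡ c (matching k)) (own₂ j ∋₂) cr≡cⱼ))
  ...   | no ∌₁  | no ∌₂  =
    inj₁ (r , matching j , cr≡cⱼ , disjoint-by-literals {r = r} {matching j} ∌₁ ∌₂)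

-- Each rᵢ has the colour of matching 0 or of matching 2, and r₁, r₂ as well as r₃, r₄ are disjoint.
-- Unless one of these pairs is monochromatic, two of the rᵢ share a colour κ, and the ridges s₁, s₁′
-- (coloured like matching 3 or 0) or s₂, s₂′ (like matching 1 or 2) complete a triangle with them.
monochromatic-pair₅₊ : ∀ n (c : Ridge (5 +ℕ n) → Fin (5 +ℕ n)) → MonochromaticPair c Disjoint
monochromatic-pair₅₊ n c = reduce do
    h₁  ← coloured-like-owner c r₁  (owns-𝟘 (# 0)) (owns-𝟘 (# 2))
    h₂  ← coloured-like-owner c r₂  (owns-𝟙 (# 0)) (owns-𝟙 (# 2))
    h₃  ← coloured-like-owner c r₃  (owns-𝟘 (# 0)) (owns-𝟙 (# 2))
    h₄  ← coloured-like-owner c r₄  (owns-𝟙 (# 0)) (owns-𝟘 (# 2))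
    h₅  ← coloured-like-owner c s₁  (owns-𝟘 (# 3)) (owns-𝟘 (# 0))
    h₅′ ← coloured-like-owner c s₁′ (owns-𝟙 (# 3)) (owns-𝟙 (# 0))
    h₆  ← coloured-like-owner c s₂  (owns-𝟘 (# 1)) (owns-𝟘 (# 2))
    h₆′ ← coloured-like-owner c s₂′ (owns-𝟙 (# 1)) (owns-𝟙 (# 2))
    pure (conclude h₁ h₂ h₃ h₄ h₅ h₅′ h₆ h₆′)
  where
  open RawMonad (Data.Sum.Effectful.Left.monad (MonochromaticPair c Disjoint) 0ℓ)
  r₁ r₂ r₃ r₄ s₁ s₁′ s₂ s₂′ : Ridge (5 +ℕ n)
  r₁  = ridge (# 0) (# 2) false false λ ()
  r₂  = ridge (# 1) (# 3) true  true  λ ()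
  r₃  = ridge (# 0) (# 3) false true  λ ()
  r₄  = ridge (# 1) (# 2) true  false λ ()
  s₁  = ridge (# 3) (# 0) false false λ ()
  s₁′ = ridge (# 4) (# 1) true  true  λ ()
  s₂  = ridge (# 1) (# 2) false false λ ()
  s₂′ = ridge (# 2) (# 3) true  true  λ ()
  conclude : LikeOwner c r₁ (# 0) (# 2) → LikeOwner c r₂ (# 0) (# 2) →
             LikeOwner c r₃ (# 0) (# 2) → LikeOwner c r₄ (# 0) (# 2) →
             LikeOwner c s₁ (# 3) (# 0) → LikeOwner c s₁′ (# 3) (# 0) →
             LikeOwner c s₂ (# 1) (# 2) → LikeOwner c s₂′ (# 1) (# 2) → MonochromaticPair c Disjoint
  conclude (inj₁ e₁) (inj₁ e₂) _ _ _ _ _ _ = r₁ , r₂ , trans e₁ (sym e₂) , disjoint r₁ r₂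
  conclude (inj₂ e₁) (inj₂ e₂) _ _ _ _ _ _ = r₁ , r₂ , trans e₁ (sym e₂) , disjoint r₁ r₂
  conclude _ _ (inj₁ e₃) (inj₁ e₄) _ _ _ _ = r₃ , r₄ , trans e₃ (sym e₄) , disjoint r₃ r₄
  conclude _ _ (inj₂ e₃) (inj₂ e₄) _ _ _ _ = r₃ , r₄ , trans e₃ (sym e₄) , disjoint r₃ r₄
  conclude (inj₁ _) (inj₂ e₂) (inj₁ _) (inj₂ e₄) _ _ h₆ h₆′ =
    triangle e₄ e₂ h₆ h₆′ (disjoint s₂ s₂′) (disjoint s₂ r₂) (disjoint s₂′ r₄)
  conclude (inj₁ e₁) (inj₂ _) (inj₂ _) (inj₁ e₄) h₅ h₅′ _ _ =
    triangle e₁ e₄ h₅ h₅′ (disjoint s₁ s₁′) (disjoint s₁ r₄) (disjoint s₁′ r₁)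
  conclude (inj₂ _) (inj₁ e₂) (inj₁ e₃) (inj₂ _) h₅ h₅′ _ _ =
    triangle e₃ e₂ h₅ h₅′ (disjoint s₁ s₁′) (disjoint s₁ r₂) (disjoint s₁′ r₃)
  conclude (inj₂ e₁) (inj₁ _) (inj₂ e₃) (inj₁ _) _ _ h₆ h₆′ =
    triangle e₁ e₃ h₆ h₆′ (disjoint s₂ s₂′) (disjoint s₂ r₃) (disjoint s₂′ r₁)

collision-or-injective : ∀ {k m} (f : Fin k → Fin m) →
                         (∃ λ i → ∃ λ j → i ≢ j × f i ≡ f j) ⊎ Injective _≡_ _≡_ f
collision-or-injective f with any? (λ i → any? λ j → ¬? (i ≟ j) ×-dec (f i ≟ f j))
... | yes (i , j , i≢j , fi≡fj) = inj₁ (i , j , i≢j , fi≡fj)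
... | no no-collision = inj₂ injective
  where
  injective : Injective _≡_ _≡_ f
  injective {i} {j} fi≡fj with i ≟ j
  ... | yes i≡j = i≡j
  ... | no  i≢j = contradiction (i , j , i≢j , fi≡fj) no-collision

module SeedTags {m} (seed-colour : Fin m → Fin (suc m)) (distinct : Injective _≡_ _≡_ seed-colour) where

  tag : Fin (suc m) → Fin (suc m)
  tag x with any? (λ k → seed-colour k ≟ x)
  ... | yes (k , _) = inject₁ k
  ... | no _        = fromℕ m

  tag-seed : ∀ k → tag (seed-colour k) ≡ inject₁ k
  tag-seed k with any? (λ k′ → seed-colour k′ ≟ seed-colour k)
  ... | yes (k′ , e) = cong inject₁ (distinct e)
  ... | no ∄k        = contradiction (k , refl) ∄k

  non-seed-unique : ∀ {x y} → (∀ k → seed-colour k ≢ x) → (∀ k → seed-colour k ≢ y) → x ≡ y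
  non-seed-unique {x} {y} x∉ y∉ with x ≟ y
  ... | yes x≡y = x≡y
  ... | no  x≢y = contradiction (injective⇒≤ all-injective) ℕ.1+n≰n
    where
    all : Fin (2 +ℕ m) → Fin (suc m)
    all zero          = x
    all (suc zero)    = y
    all (suc (suc k)) = seed-colour k
    all-injective : Injective _≡_ _≡_ all
    all-injective {zero}          {zero}          _ = refl
    all-injective {zero}          {suc zero}      e = contradiction e x≢y
    all-injective {zero}          {suc (suc k)}   e = contradiction (sym e) (x∉ k)
    all-injective {suc zero}      {zero}          e = contradiction (sym e) x≢y
    all-injective {suc zero}      {suc zero}      _ = refl
    all-injective {suc zero}      {suc (suc k)}   e = contradiction (sym e) (y∉ k)
    all-injective {suc (suc k)}   {zero}          e = contradiction e (x∉ k)
    all-injective {suc (suc k)}   {suc zero}      e = contradiction e (y∉ k)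
    all-injective {suc (suc k)}   {suc (suc k′)}  e = cong (λ k → suc (suc k)) (distinct e)

  tag-injective : Injective _≡_ _≡_ tag
  tag-injective {x} {y} tx≡ty with any? (λ k → seed-colour k ≟ x) | any? (λ k → seed-colour k ≟ y)
  ... | yes (k , refl) | yes (k′ , refl) = cong seed-colour (inject₁-injective tx≡ty)
  ... | yes (k , _)    | no _            = contradiction (sym tx≡ty) fromℕ≢inject₁
  ... | no _           | yes (k′ , _)    = contradiction tx≡ty fromℕ≢inject₁
  ... | no x∉          | no y∉           = non-seed-unique (λ k → x∉ ∘ (k ,_)) (λ k → y∉ ∘ (k ,_))

module DecisionTree {I : Set} {m : ℕ} (Good : I → I → Set) (good? : ∀ r s → Dec (Good r s)) where

  Colour : Set
  Colour = Fin (suc m)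

  History : Set
  History = List (I × Colour)

  -- Branch t of  ask r ts  records r with colour t in the history; a leaf  pair k  closes the
  -- branch by pairing that r with the k-th earlier entry.  Colours are relabelled by SeedTags, so
  -- seed k has colour k and every colour not taken by a seed is the last one.
  data Tree : Set where
    pair : ℕ → Tree
    ask  : I → Vec Tree (suc m) → Tree

  Closes : I → Colour → ℕ → History → Set
  Closes r t k       []              = ⊥
  Closes r t zero    ((s , t′) ∷ _) = True (t ≟ t′) × True (good? r s)
  Closes r t (suc k) (_ ∷ h)         = Closes r t k h

  mutual
    Valid : Tree → History → Set
    Valid (pair k)   []            = ⊥
    Valid (pair k)   ((r , t) ∷ h) = Closes r t k h
    Valid (ask r ts) h             = ValidBranches r h ts (allFin (suc m))

    ValidBranches : ∀ {n} → I → History → Vec Tree n → Vec Colour n → Set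
    ValidBranches r h []       []       = ⊤
    ValidBranches r h (t ∷ ts) (c ∷ cs) = Valid t ((r , c) ∷ h) × ValidBranches r h ts cs

  module _ (κ : I → Colour) where

    Recorded : History → Set
    Recorded = All λ (s , t) → κ s ≡ t

    closes-sound : ∀ r t k h → κ r ≡ t → Recorded h → Closes r t k h → MonochromaticPair κ Good
    closes-sound r t zero    ((s , t′) ∷ _) κr≡t (κs≡t′ ∷ _) (t≡t′ , good) =
      r , s , trans κr≡t (trans (toWitness t≡t′) (sym κs≡t′)) , toWitness good
    closes-sound r t (suc k) (_ ∷ h) κr≡t (_ ∷ rec) closes = closes-sound r t k h κr≡t rec closes

    mutual
      sound : ∀ tree h → Recorded h → Valid tree h → MonochromaticPair κ Good
      sound (pair k)   ((r , t) ∷ h) (κr≡t ∷ rec) valid = closes-sound r t k h κr≡t rec valid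
      sound (ask r ts) h             rec          valid =
        sound-branches r h rec ts (allFin (suc m)) valid (κ r) (sym (lookup-allFin (κ r)))

      sound-branches : ∀ {n} r h → Recorded h → (ts : Vec Tree n) (cs : Vec Colour n) →
                       ValidBranches r h ts cs → ∀ i → κ r ≡ lookup cs i → MonochromaticPair κ Good
      sound-branches r h rec (t ∷ _)  (c ∷ _)  (valid , _) zero    κr≡c =
        sound t ((r , c) ∷ h) (κr≡c ∷ rec) valid
      sound-branches r h rec (_ ∷ ts) (_ ∷ cs) (_ , valid) (suc i) κr≡c =
        sound-branches r h rec ts cs valid i κr≡c

  seed-history : (Fin m → I) → History
  seed-history seed = tabulate λ k → seed k , inject₁ k

  pairwise-good? : (seed : Fin m → I) → Dec (∀ i j → i ≢ j → Good (seed i) (seed j))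
  pairwise-good? seed = all? λ i → all? λ j → ¬? (i ≟ j) →-dec good? (seed i) (seed j)

  certified-monochromatic-pair : (seed : Fin m → I) (tree : Tree) →
                                 {True (pairwise-good? seed)} → {Valid tree (seed-history seed)} →
                                 (c : I → Colour) → MonochromaticPair c Good
  certified-monochromatic-pair seed tree {seeds-good} {valid} c with collision-or-injective (c ∘ seed)
  ... | inj₁ (i , j , i≢j , same) = seed i , seed j , same , toWitness seeds-good i j i≢j
  ... | inj₂ distinct = relabel (sound (tag ∘ c) tree (seed-history seed) (tabulate⁺ tag-seed) valid)
    where
    open SeedTags (c ∘ seed) distinct
    relabel : MonochromaticPair (tag ∘ c) Good → MonochromaticPair c Good
    relabel (r , s , tags≡ , good) = r , s , tag-injective tags≡ , good

monochromatic-pair₃ : (c : Ridge 3 → Fin 3) → MonochromaticPair c (AntipodalFaces 0)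
monochromatic-pair₃ = certified-monochromatic-pair seed tree
  where
  open DecisionTree {m = 2} (AntipodalFaces 0) (antipodalFaces? 0)
  r00X r01X r0X0 r10X r1X0 r1X1 rX01 rX10 rX11 : Ridge 3
  r00X = ridge (# 0) (# 1) false false λ ()
  r01X = ridge (# 0) (# 1) false true  λ ()
  r0X0 = ridge (# 0) (# 2) false false λ ()
  r10X = ridge (# 0) (# 1) true  false λ ()
  r1X0 = ridge (# 0) (# 2) true  false λ ()
  r1X1 = ridge (# 0) (# 2) true  true  λ ()
  rX01 = ridge (# 1) (# 2) false true  λ ()
  rX10 = ridge (# 1) (# 2) true  false λ ()
  rX11 = ridge (# 1) (# 2) true  true  λ ()
  seed : Fin 2 → Ridge 3
  seed zero       = r01X
  seed (suc zero) = rX01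
  tree : Tree
  tree = ask r1X0
         ( pair 0 ∷ pair 1
         ∷ ask r00X
           ( ask r10X
             ( pair 2 ∷ ask rX11 (pair 1 ∷ pair 0 ∷ pair 2 ∷ [])
             ∷ ask rX10 (pair 1 ∷ pair 4 ∷ pair 0 ∷ []) ∷ [])
           ∷ ask r0X0
             ( ask rX11 (pair 0 ∷ pair 1 ∷ pair 2 ∷ []) ∷ pair 3
             ∷ ask r1X1 (pair 3 ∷ pair 1 ∷ pair 0 ∷ []) ∷ [])
           ∷ pair 0 ∷ [])
         ∷ [])

monochromatic-pair₄ : (c : Ridge 4 → Fin 4) → MonochromaticPair c (AntipodalFaces 1)
monochromatic-pair₄ = certified-monochromatic-pair seed tree
  where
  open DecisionTree {m = 3} (AntipodalFaces 1) (antipodalFaces? 1)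
  r00XX r01XX r0X0X r0X1X r0XX0 r0XX1 r10XX r11XX r1X0X r1X1X r1XX1
    rX00X rX01X rX0X0 rX0X1 rX10X rX11X rX1X0 rX1X1 rXX00 rXX10 : Ridge 4
  r00XX = ridge (# 0) (# 1) false false λ ()
  r01XX = ridge (# 0) (# 1) false true  λ ()
  r0X0X = ridge (# 0) (# 2) false false λ ()
  r0X1X = ridge (# 0) (# 2) false true  λ ()
  r0XX0 = ridge (# 0) (# 3) false false λ ()
  r0XX1 = ridge (# 0) (# 3) false true  λ ()
  r10XX = ridge (# 0) (# 1) true  false λ ()
  r11XX = ridge (# 0) (# 1) true  true  λ ()
  r1X0X = ridge (# 0) (# 2) true  false λ ()
  r1X1X = ridge (# 0) (# 2) true  true  λ ()
  r1XX1 = ridge (# 0) (# 3) true  true  λ ()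
  rX00X = ridge (# 1) (# 2) false false λ ()
  rX01X = ridge (# 1) (# 2) false true  λ ()
  rX0X0 = ridge (# 1) (# 3) false false λ ()
  rX0X1 = ridge (# 1) (# 3) false true  λ ()
  rX10X = ridge (# 1) (# 2) true  false λ ()
  rX11X = ridge (# 1) (# 2) true  true  λ ()
  rX1X0 = ridge (# 1) (# 3) true  false λ ()
  rX1X1 = ridge (# 1) (# 3) true  true  λ ()
  rXX00 = ridge (# 2) (# 3) false false λ ()
  rXX10 = ridge (# 2) (# 3) true  false λ ()
  seed : Fin 3 → Ridge 4
  seed zero             = r00XX
  seed (suc zero)       = r1X0X
  seed (suc (suc zero)) = rX11X
  tree : Tree
  tree = ask r0XX1
         ( ask r10XX
           ( pair 0
           ∷ ask rX10X
             ( pair 2 ∷ pair 0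
             ∷ ask rXX10
               ( pair 2 ∷ pair 4 ∷ pair 0
               ∷ ask r0X0X
                 ( ask rX01X
                   ( pair 0 ∷ pair 6 ∷ pair 2
                   ∷ ask rX1X0
                     ( pair 5 ∷ pair 4
                     ∷ ask r1XX1
                       ( pair 2 ∷ ask rXX00 (pair 7 ∷ pair 0 ∷ pair 10 ∷ pair 2 ∷ []) ∷ pair 0
                       ∷ pair 3 ∷ [])
                     ∷ pair 0 ∷ [])
                   ∷ [])
                 ∷ pair 2 ∷ pair 6 ∷ pair 0 ∷ [])
               ∷ [])
             ∷ ask rX0X0
               ( pair 2
               ∷ ask rXX10
                 ( pair 3 ∷ pair 5
                 ∷ ask r1XX1
                   ( pair 5 ∷ pair 1 ∷ pair 0
                   ∷ ask r0X0X
                     ( ask rX01X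
                       ( pair 0 ∷ pair 8 ∷ ask rX1X0 (pair 7 ∷ pair 6 ∷ pair 0 ∷ pair 2 ∷ [])
                       ∷ pair 4 ∷ [])
                     ∷ pair 4 ∷ pair 1 ∷ pair 0 ∷ [])
                   ∷ [])
                 ∷ pair 1 ∷ [])
               ∷ pair 5 ∷ pair 0 ∷ [])
             ∷ [])
           ∷ pair 3
           ∷ ask rXX00
             ( pair 1
             ∷ ask rX1X1
               ( pair 3 ∷ pair 0
               ∷ ask r0XX0
                 ( ask rX0X1
                   ( pair 0 ∷ pair 2 ∷ pair 7 ∷ ask rXX10 (pair 5 ∷ pair 7 ∷ pair 2 ∷ pair 0 ∷ [])
                   ∷ [])
                 ∷ pair 5 ∷ pair 0 ∷ pair 2 ∷ [])
               ∷ pair 1 ∷ [])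
             ∷ pair 4
             ∷ ask r01XX
               ( ask rX01X
                 ( pair 0 ∷ pair 5
                 ∷ ask rX10X
                   ( pair 5 ∷ ask rX0X1 (pair 2 ∷ pair 0 ∷ pair 8 ∷ pair 3 ∷ []) ∷ pair 0 ∷ pair 3
                   ∷ [])
                 ∷ pair 1 ∷ [])
               ∷ pair 4
               ∷ ask r1X1X
                 ( pair 3
                 ∷ ask r0X0X
                   ( ask rX01X (pair 0 ∷ pair 7 ∷ pair 2 ∷ pair 3 ∷ []) ∷ pair 0 ∷ pair 7 ∷ pair 3
                   ∷ [])
                 ∷ pair 0 ∷ pair 1 ∷ [])
               ∷ pair 1 ∷ [])
             ∷ [])
           ∷ [])
         ∷ pair 1
         ∷ ask rX1X0
           ( pair 1
           ∷ ask rXX10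
             ( ask rX00X
               ( pair 0 ∷ pair 1 ∷ pair 5
               ∷ ask r11XX
                 ( pair 4
                 ∷ ask r0X0X
                   ( pair 2 ∷ pair 0 ∷ pair 7
                   ∷ ask r10XX
                     ( ask r01XX
                       ( pair 0 ∷ pair 8 ∷ ask r1XX1 (pair 5 ∷ pair 6 ∷ pair 0 ∷ pair 2 ∷ [])
                       ∷ pair 3 ∷ [])
                     ∷ pair 4 ∷ pair 5 ∷ pair 0 ∷ [])
                   ∷ [])
                 ∷ pair 3 ∷ pair 0 ∷ [])
               ∷ [])
             ∷ pair 3 ∷ pair 1
             ∷ ask r1XX1
               ( pair 3 ∷ pair 1
               ∷ ask rX00X
                 ( ask r01XX
                   ( pair 0 ∷ pair 6 ∷ pair 1
                   ∷ ask r10XX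
                     ( ask r0X0X
                       ( pair 0 ∷ ask r1X1X (pair 3 ∷ pair 0 ∷ pair 7 ∷ pair 2 ∷ []) ∷ pair 3
                       ∷ pair 4 ∷ [])
                     ∷ pair 4 ∷ pair 5 ∷ pair 0 ∷ [])
                   ∷ [])
                 ∷ pair 2 ∷ pair 6 ∷ pair 1 ∷ [])
               ∷ pair 0 ∷ [])
             ∷ [])
           ∷ pair 0
           ∷ ask rXX10
             ( ask rX00X
               ( pair 0
               ∷ ask r11XX
                 ( pair 4 ∷ pair 0 ∷ pair 3
                 ∷ ask r0X0X
                   ( pair 2
                   ∷ ask r10XX
                     ( ask r0X1X
                       ( pair 0 ∷ pair 3 ∷ ask r1XX1 (pair 5 ∷ pair 2 ∷ pair 0 ∷ pair 6 ∷ [])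
                       ∷ pair 2 ∷ [])
                     ∷ pair 0 ∷ pair 5 ∷ pair 4 ∷ [])
                   ∷ pair 7 ∷ pair 0 ∷ [])
                 ∷ [])
               ∷ pair 5 ∷ pair 1 ∷ [])
             ∷ pair 3 ∷ pair 1
             ∷ ask r10XX
               ( ask r0X0X
                 ( pair 0
                 ∷ ask r11XX
                   ( pair 5 ∷ pair 0 ∷ pair 4
                   ∷ ask r0X1X
                     ( pair 2 ∷ pair 7 ∷ ask r1XX1 (pair 7 ∷ pair 2 ∷ pair 0 ∷ pair 4 ∷ []) ∷ pair 0
                     ∷ [])
                   ∷ [])
                 ∷ pair 6 ∷ pair 1 ∷ [])
               ∷ ask r0X0X
                 ( ask rX01X
                   ( pair 0 ∷ pair 6 ∷ ask rX10X (pair 6 ∷ pair 2 ∷ pair 0 ∷ pair 3 ∷ []) ∷ pair 3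
                   ∷ [])
                 ∷ pair 0 ∷ pair 6 ∷ pair 1 ∷ [])
               ∷ pair 2 ∷ pair 1 ∷ [])
             ∷ [])
           ∷ [])
         ∷ ask rXX00
           ( ask r10XX
             ( ask r01XX
               ( pair 0 ∷ pair 4
               ∷ ask r1X1X
                 ( pair 2
                 ∷ ask r0X0X
                   ( pair 2 ∷ pair 0 ∷ pair 7 ∷ ask rX01X (pair 4 ∷ pair 7 ∷ pair 2 ∷ pair 0 ∷ [])
                   ∷ [])
                 ∷ pair 0 ∷ pair 3 ∷ [])
               ∷ ask rX01X
                 ( pair 2 ∷ pair 5
                 ∷ ask r11XX
                   ( pair 5 ∷ ask rX0X1 (pair 4 ∷ pair 0 ∷ pair 8 ∷ pair 2 ∷ []) ∷ pair 0 ∷ pair 4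
                   ∷ [])
                 ∷ pair 0 ∷ [])
               ∷ [])
             ∷ ask rX1X0
               ( pair 3 ∷ pair 0
               ∷ ask rX01X
                 ( pair 2 ∷ pair 5 ∷ pair 0
                 ∷ ask r0X0X
                   ( ask rX10X
                     ( pair 6 ∷ pair 3 ∷ ask rXX10 (pair 1 ∷ pair 8 ∷ pair 0 ∷ pair 6 ∷ []) ∷ pair 1
                     ∷ [])
                   ∷ pair 2 ∷ pair 7 ∷ pair 0 ∷ [])
                 ∷ [])
               ∷ pair 2 ∷ [])
             ∷ pair 4 ∷ pair 1 ∷ [])
           ∷ ask r1X1X
             ( pair 2 ∷ pair 0
             ∷ ask r01XX
               ( ask r10XX
                 ( pair 0
                 ∷ ask rX10X
                   ( pair 5 ∷ pair 0 ∷ pair 2 ∷ ask rX0X1 (pair 2 ∷ pair 4 ∷ pair 8 ∷ pair 0 ∷ [])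
                   ∷ [])
                 ∷ pair 6 ∷ pair 3 ∷ [])
               ∷ pair 4 ∷ pair 0
               ∷ ask r1XX1
                 ( pair 4 ∷ pair 2
                 ∷ ask rX0X1
                   ( ask rXX10 (pair 0 ∷ pair 7 ∷ pair 1 ∷ pair 5 ∷ []) ∷ pair 3 ∷ pair 7 ∷ pair 1
                   ∷ [])
                 ∷ pair 0 ∷ [])
               ∷ [])
             ∷ pair 1 ∷ [])
           ∷ pair 3 ∷ pair 0 ∷ [])
         ∷ [])

-- Colouring ridges by a cover

module _ {d} (A : Fin d → RidgeUnion d) (cover : RidgeCover d d A) where

  class : Ridge d → Fin d
  class r = proj₁ (proj₂ cover (word ⟦ r ⟧) (⟦⟧-isRidge r))

  lies-in-class : ∀ r → LiesIn (A (class r)) ⟦ r ⟧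
  lies-in-class r = ⊆U⇒LiesIn ⟦ r ⟧ (proj₂ (proj₂ cover (word ⟦ r ⟧) (⟦⟧-isRidge r)))

  antipodal-in-class : ∀ {k} → MonochromaticPair class (AntipodalFaces k) →
                       ∃ λ i → ContainsAntipodal (A i) (+ k)
  antipodal-in-class {k} (r , s , same , disj , k≤) =
    class r , antipodal-faces (lies-in-class r) s-in-class (Disjoint⇒Apart {r = r} {s} disj) k k≤
    where
    s-in-class : LiesIn (A (class r)) ⟦ s ⟧
    s-in-class = subst (λ i → LiesIn (A i) ⟦ s ⟧) (sym same) (lies-in-class s)

-- Covers without antipodal faces

module PointCover where

  A : Fin 1 → RidgeUnion 1
  A _ R = R ≡ empty

  cover : RidgeCover 1 1 A
  cover = (λ { _ _ refl → refl }) , λ { empty _ → zero , λ _ () }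

  no-antipodal : ∀ i → ¬ ContainsAntipodal (A i) (+ 0)
  no-antipodal i (word u , _ , _ , _ , _ , u⊆ , _) with ⊆U⇒LiesIn u u⊆
  ... | _ , () , _

firstFixed : ∀ {d} → Word d → Maybe Bool
firstFixed {zero}  _ = nothing
firstFixed {suc d} w = fromLetter (w zero)
  where
  fromLetter : Letter → Maybe Bool
  fromLetter 𝟘 = just false
  fromLetter 𝟙 = just true
  fromLetter X = firstFixed (tail w)

firstFixed-cong : ∀ {d} {u v : Word d} → (∀ j → u j ≡ v j) → firstFixed u ≡ firstFixed v
firstFixed-cong {zero}  _ = refl
firstFixed-cong {suc d} {u} {v} u≗v with u zero | v zero | u≗v zero
... | 𝟘 | .𝟘 | refl = refl
... | 𝟙 | .𝟙 | refl = refl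
... | X | .X | refl = firstFixed-cong (λ j → u≗v (suc j))

firstFixed-antipodal : ∀ {d} {u v : Word d} → (∀ j → oppL (u j) (v j)) →
                       firstFixed v ≡ Maybe.map not (firstFixed u)
firstFixed-antipodal {zero}  _ = refl
firstFixed-antipodal {suc d} {u} {v} opp with u zero | v zero | opp zero
... | 𝟘 | 𝟙 | _ = refl
... | 𝟙 | 𝟘 | _ = refl
... | X | X | _ = firstFixed-antipodal (λ j → opp (suc j))

firstFixed-nothing : ∀ {d} (w : Word d) → firstFixed w ≡ nothing → countX w ≡ d
firstFixed-nothing {zero}  _ _ = refl
firstFixed-nothing {suc d} w none with w zero
... | X = cong suc (firstFixed-nothing (tail w) none)

module FirstFixedCover (m : ℕ) where

  side : Fin (2 +ℕ m) → Bool
  side zero    = false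
  side (suc _) = true

  A : Fin (2 +ℕ m) → RidgeUnion (2 +ℕ m)
  A i empty    = ⊥
  A i (word w) = IsRidge (word w) × firstFixed w ≡ just (side i)

  cover : RidgeCover (2 +ℕ m) (2 +ℕ m) A
  cover = (λ { i (word w) (isRidge , _) → isRidge }) , covered
    where
    covered : ∀ R → IsRidge R → ∃ λ i → R ⊆U A i
    covered (word w) isRidge with firstFixed w in first
    ... | just false = zero     , λ p p∈w → word w , (isRidge , first) , p∈w
    ... | just true  = suc zero , λ p p∈w → word w , (isRidge , first) , p∈w
    ... | nothing    = contradiction
      (trans (IsRidge⇒countX w isRidge) (sym (firstFixed-nothing w first))) (ℕ.m+1+n≢m (countX w))

  -- A face of the dimension of a ridge lies in a ridge only if it is that ridge.
  side-of : ∀ i (w : Word (2 +ℕ m)) → word w ⊆U A i → countX w ≡ m → firstFixed w ≡ just (side i)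
  side-of i w w⊆ dim-w with ⊆U⇒LiesIn w w⊆
  ... | r , (isRidge , first) , w⊑r =
    trans (firstFixed-cong (⊑ʷ-tight w⊑r (ℕ.≤-reflexive (trans r-dim (sym dim-w))))) first
    where
    r-dim : countX r ≡ m
    r-dim = ℕ.+-cancelʳ-≡ 2 _ _ (trans (IsRidge⇒countX r isRidge) (ℕ.+-comm 2 m))

  no-antipodal : ∀ i → ¬ ContainsAntipodal (A i) (+ m)
  no-antipodal i (word u , word v , dim-u , dim-v , opp , u⊆ , v⊆) = not-¬ refl (just-injective (begin
    just (side i)                    ≡⟨ side-of i v v⊆ (ℤ.+-injective dim-v) ⟨
    firstFixed v                     ≡⟨ firstFixed-antipodal opp ⟩
    Maybe.map not (firstFixed u)     ≡⟨ cong (Maybe.map not) (side-of i u u⊆ (ℤ.+-injective dim-u)) ⟩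
    just (not (side i))              ∎))
    where open ≡-Reasoning

fix-⊑-⟦⟧ : ∀ {d} (s : Fin d → Bool) (r : Ridge d) → s (pos₁ r) ≡ val₁ r → s (pos₂ r) ≡ val₂ r →
           ∀ j → fix (s j) ⊑ ⟦ r ⟧ j
fix-⊑-⟦⟧ s r s₁ s₂ j with letter-view (⟦ r ⟧ j)
... | inj₁ rj≡X = subst (fix (s j) ⊑_) (sym rj≡X) ⊑-X
... | inj₂ (b , rj≡b) with ⟦⟧-fixed r rj≡b
...   | inj₁ refl = subst (fix (s j) ⊑_) (sym rj≡b) (subst (λ b → fix b ⊑ fix (val₁ r)) (sym s₁) ⊑-refl)
...   | inj₂ refl = subst (fix (s j) ⊑_) (sym rj≡b) (subst (λ b → fix b ⊑ fix (val₂ r)) (sym s₂) ⊑-refl)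

CoveringArray : ∀ {d} → (Fin d → Fin d → Bool) → Set
CoveringArray {d} σ = ∀ {a b} → a ≢ b → ∀ u v → ∃ λ i → σ i a ≡ u × σ i b ≡ v

module PatternCover {m} (σ : Fin (2 +ℕ m) → Fin (2 +ℕ m) → Bool) (covering : CoveringArray σ) where

  d : ℕ
  d = 2 +ℕ m

  A : Fin d → RidgeUnion d
  A i empty    = ⊥
  A i (word w) = IsRidge (word w) × (∀ j → fix (σ i j) ⊑ w j)

  cover : RidgeCover d d A
  cover = (λ { i (word w) (isRidge , _) → isRidge }) , covered
    where
    covered : ∀ R → IsRidge R → ∃ λ i → R ⊆U A i
    covered (word w) isRidge with ridge-view w (IsRidge⇒countX w isRidge)
    ... | r , w≗r with covering (pos₁≢pos₂ r) (val₁ r) (val₂ r)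
    ...   | i , σ₁ , σ₂ = i , λ p p∈w → word w , (isRidge , agree) , p∈w
      where
      agree : ∀ j → fix (σ i j) ⊑ w j
      agree j = subst (fix (σ i j) ⊑_) (sym (w≗r j)) (fix-⊑-⟦⟧ (σ i) r σ₁ σ₂ j)

  -- Two fixed letters of a class agree with the same row, so they cannot be opposite.
  antipodal-pointwise : ∀ {x y a b} s → x ⊑ a → y ⊑ b → oppL x y → fix s ⊑ a → fix s ⊑ b →
                        1 +ℕ isX x ≤ isX a +ℕ isX b
  antipodal-pointwise {X} {X} _     x⊑a    y⊑b    _ _ _ = ℕ.+-mono-≤ (isX-mono x⊑a) (isX-mono y⊑b)
  antipodal-pointwise {𝟘} {𝟙} _     ⊑-X    _      _ _ _ = s≤s z≤n
  antipodal-pointwise {𝟘} {𝟙} _     ⊑-refl ⊑-X    _ _ _ = s≤s z≤n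
  antipodal-pointwise {𝟘} {𝟙} false ⊑-refl ⊑-refl _ _ ()
  antipodal-pointwise {𝟘} {𝟙} true  ⊑-refl ⊑-refl _ () _
  antipodal-pointwise {𝟙} {𝟘} _     ⊑-X    _      _ _ _ = s≤s z≤n
  antipodal-pointwise {𝟙} {𝟘} _     ⊑-refl ⊑-X    _ _ _ = s≤s z≤n
  antipodal-pointwise {𝟙} {𝟘} false ⊑-refl ⊑-refl _ () _
  antipodal-pointwise {𝟙} {𝟘} true  ⊑-refl ⊑-refl _ _ ()

  no-antipodal : ∀ i k → d ≤ k +ℕ 3 → ¬ ContainsAntipodal (A i) (+ k)
  no-antipodal i k d≤k+3 (word u , word v , dim-u , dim-v , opp , u⊆ , v⊆)
    with ⊆U⇒LiesIn u u⊆ | ⊆U⇒LiesIn v v⊆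
  ... | r , (r-ridge , r-row) , u⊑r | r′ , (r′-ridge , r′-row) , v⊑r′ =
    contradiction (ℕ.+-cancelˡ-≤ k 4 3 (ℕ.≤-trans k+4≤d d≤k+3)) ℕ.1+n≰n
    where
    open ℕ.≤-Reasoning
    sum : d +ℕ k ≤ countX r +ℕ countX r′
    sum = subst₂ (λ a b → a +ℕ b ≤ countX r +ℕ countX r′) (countX-allX d) (ℤ.+-injective dim-u)
            (countX-mono₂ allX u r r′ λ j →
              antipodal-pointwise (σ i j) (u⊑r j) (v⊑r′ j) (opp j) (r-row j) (r′-row j))
    k+4≤d : k +ℕ 4 ≤ d
    k+4≤d = ℕ.+-cancelˡ-≤ d _ _ (begin
      d +ℕ (k +ℕ 4)                         ≡⟨ ℕ.+-assoc d k 4 ⟨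
      d +ℕ k +ℕ 4                           ≤⟨ ℕ.+-monoˡ-≤ 4 sum ⟩
      countX r +ℕ countX r′ +ℕ 4            ≡⟨ add-two-each (countX r) (countX r′) ⟩
      (countX r +ℕ 2) +ℕ (countX r′ +ℕ 2)   ≡⟨ cong₂ _+ℕ_ (IsRidge⇒countX r r-ridge)
                                                           (IsRidge⇒countX r′ r′-ridge) ⟩
      d +ℕ d                                ∎)
      where
      add-two-each : ∀ a b → a +ℕ b +ℕ 4 ≡ (a +ℕ 2) +ℕ (b +ℕ 2)
      add-two-each = solve-∀

-- Column a is labelled by the pair {low a, high a} ⊆ {0, …, 3 + n}, distinct columns by distinct
-- pairs; apart from two constant rows, row 2 + c marks the columns whose pair contains c.
module PairArray (n : ℕ) where

  low high : Fin (6 +ℕ n) → ℕ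
  low zero                = 0
  low (suc zero)          = 1
  low (suc (suc zero))    = 0
  low (suc (suc (suc j))) = toℕ j
  high zero                = 2
  high (suc zero)          = 3
  high (suc (suc zero))    = 3
  high (suc (suc (suc j))) = suc (toℕ j)

  low<high : ∀ a → low a < high a
  low<high zero                = s≤s z≤n
  low<high (suc zero)          = s≤s (s≤s z≤n)
  low<high (suc (suc zero))    = s≤s z≤n
  low<high (suc (suc (suc j))) = ℕ.n<1+n (toℕ j)

  high<4+n : ∀ a → high a < 4 +ℕ n
  high<4+n zero                = s≤s (s≤s (s≤s z≤n))
  high<4+n (suc zero)          = s≤s (s≤s (s≤s (s≤s z≤n)))
  high<4+n (suc (suc zero))    = s≤s (s≤s (s≤s (s≤s z≤n)))
  high<4+n (suc (suc (suc j))) = s≤s (toℕ<n j)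

  consecutive : ∀ a {j} → low a ≡ j → high a ≡ suc j → suc (low a) ≡ high a
  consecutive _ refl h = sym h

  pair-injective : ∀ {a b} → low a ≡ low b → high a ≡ high b → a ≡ b
  pair-injective {zero}              {zero}              _  _  = refl
  pair-injective {suc zero}          {suc zero}          _  _  = refl
  pair-injective {suc (suc zero)}    {suc (suc zero)}    _  _  = refl
  pair-injective {suc (suc (suc i))} {suc (suc (suc j))} li _  =
    cong (λ k → suc (suc (suc k))) (toℕ-injective li)
  pair-injective {zero}              {suc (suc (suc j))} li hi =
    contradiction (consecutive zero li hi) λ ()
  pair-injective {suc zero}          {suc (suc (suc j))} li hi =
    contradiction (consecutive (suc zero) li hi) λ ()
  pair-injective {suc (suc zero)}    {suc (suc (suc j))} li hi =
    contradiction (consecutive (suc (suc zero)) li hi) λ ()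
  pair-injective {suc (suc (suc i))} {zero}              li hi =
    contradiction (consecutive zero (sym li) (sym hi)) λ ()
  pair-injective {suc (suc (suc i))} {suc zero}          li hi =
    contradiction (consecutive (suc zero) (sym li) (sym hi)) λ ()
  pair-injective {suc (suc (suc i))} {suc (suc zero)}    li hi =
    contradiction (consecutive (suc (suc zero)) (sym li) (sym hi)) λ ()

  _∈ₚ_ : ℕ → Fin (6 +ℕ n) → Set
  c ∈ₚ a = c ≡ low a ⊎ c ≡ high a

  _∈ₚ?_ : ∀ c a → Dec (c ∈ₚ a)
  c ∈ₚ? a = (c ℕ.≟ low a) ⊎-dec (c ℕ.≟ high a)

  separate : ∀ {a b} → a ≢ b → ∃ λ c → c < 4 +ℕ n × c ∈ₚ a × ¬ c ∈ₚ b
  separate {a} {b} a≢b with low a ∈ₚ? b | high a ∈ₚ? b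
  ... | no ∉b | _     = low a , ℕ.<-trans (low<high a) (high<4+n a) , inj₁ refl , ∉b
  ... | yes _ | no ∉b = high a , high<4+n a , inj₂ refl , ∉b
  ... | yes (inj₁ l≡l) | yes (inj₂ h≡h) = contradiction (pair-injective l≡l h≡h) a≢b
  ... | yes (inj₁ l≡l) | yes (inj₁ h≡l) = ⊥-elim (ℕ.<-irrefl (trans l≡l (sym h≡l)) (low<high a))
  ... | yes (inj₂ l≡h) | yes (inj₂ h≡h) = ⊥-elim (ℕ.<-irrefl (trans l≡h (sym h≡h)) (low<high a))
  ... | yes (inj₂ l≡h) | yes (inj₁ h≡l) =
    ⊥-elim (ℕ.<-asym (subst₂ _<_ (sym h≡l) (sym l≡h) (low<high b)) (low<high a))

  σ : Fin (6 +ℕ n) → Fin (6 +ℕ n) → Bool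
  σ zero          _ = true
  σ (suc zero)    _ = false
  σ (suc (suc c)) a = does (toℕ c ∈ₚ? a)

  marking-row : ∀ {a b} → (∃ λ c → c < 4 +ℕ n × c ∈ₚ a × ¬ c ∈ₚ b) →
                ∃ λ i → σ i a ≡ true × σ i b ≡ false
  marking-row {a} {b} (c , c< , c∈a , c∉b) = suc (suc (fromℕ< c<)) ,
    subst (λ x → does (x ∈ₚ? a) ≡ true)  (sym (toℕ-fromℕ< c<)) (dec-true  (c ∈ₚ? a) c∈a) ,
    subst (λ x → does (x ∈ₚ? b) ≡ false) (sym (toℕ-fromℕ< c<)) (dec-false (c ∈ₚ? b) c∉b)

  covering : CoveringArray σ
  covering _   true  true  = zero , refl , refl
  covering _   false false = suc zero , refl , refl
  covering a≢b true  false = marking-row (separate a≢b)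
  covering a≢b false true with marking-row (separate (a≢b ∘ sym))
  ... | i , σb , σa = i , σa , σb

empty-antipodal : ∀ {d} {A : RidgeUnion d} → ContainsAntipodal A (+ 0 - + 1)
empty-antipodal = empty , empty , refl , refl , tt , (λ _ ()) , (λ _ ())

some-class-has-antipodal-faces : (d : ℕ) → 1 ≤ d → (A : Fin d → RidgeUnion d) → RidgeCover d d A →
                                 ∃ λ (i : Fin d) → ContainsAntipodal (A i) (kd d)
some-class-has-antipodal-faces 1 _ A cover = zero , empty-antipodal
some-class-has-antipodal-faces 2 _ A cover = zero , empty-antipodal
some-class-has-antipodal-faces 3 _ A cover =
  antipodal-in-class A cover (monochromatic-pair₃ (class A cover))
some-class-has-antipodal-faces 4 _ A cover =
  antipodal-in-class A cover (monochromatic-pair₄ (class A cover))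
some-class-has-antipodal-faces (suc (suc (suc (suc (suc n))))) _ A cover =
  antipodal-in-class A cover (map-pair disjoint⇒antipodalFaces (monochromatic-pair₅₊ n (class A cover)))

cover-without-antipodal-faces : (d : ℕ) → 1 ≤ d → d ≢ 5 →
                                Σ (Fin d → RidgeUnion d) λ A → RidgeCover d d A ×
                                  ((i : Fin d) → ¬ ContainsAntipodal (A i) (kd d + + 1))
cover-without-antipodal-faces 1 _ _ = PointCover.A , PointCover.cover , PointCover.no-antipodal
cover-without-antipodal-faces 2 _ _ =
  FirstFixedCover.A 0 , FirstFixedCover.cover 0 , FirstFixedCover.no-antipodal 0
cover-without-antipodal-faces 3 _ _ =
  FirstFixedCover.A 1 , FirstFixedCover.cover 1 , FirstFixedCover.no-antipodal 1
cover-without-antipodal-faces 4 _ _ =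
  FirstFixedCover.A 2 , FirstFixedCover.cover 2 , FirstFixedCover.no-antipodal 2
cover-without-antipodal-faces 5 _ 5≢5 = contradiction refl 5≢5
cover-without-antipodal-faces (suc (suc (suc (suc (suc (suc n)))))) _ _ = A , cover , λ i →
  -- kd (6 + n) + + 1 reduces to + (2 + n + 1)
  subst (λ k → ¬ ContainsAntipodal (A i) k) (cong +_ (sym (ℕ.+-comm (2 +ℕ n) 1)))
    (no-antipodal i (3 +ℕ n) (ℕ.≤-reflexive (ℕ.+-comm 3 (3 +ℕ n))))
  where open PatternCover (PairArray.σ n) (PairArray.covering n)

theorem1 : ((d : ℕ) → 1 ≤ d → (A : Fin d → RidgeUnion d) → RidgeCover d d A →
      ∃ λ (i : Fin d) → ContainsAntipodal (A i) (kd d))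
    ×
    ((d : ℕ) → 1 ≤ d → d ≢ 5 →
      Σ (Fin d → RidgeUnion d) λ A → RidgeCover d d A ×
        ((i : Fin d) → ¬ ContainsAntipodal (A i) (kd d + + 1)))
theorem1 = some-class-has-antipodal-faces , cover-without-antipodal-faces
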